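{- Let $d\ge1$ be an integer and let $H(X,Y)$ be a binary form of degree $d$ with integer coefficients. Suppose that there exist positive integers $D,N,\nu$ with $\gcd(D,N)=1$ such that $$\{D^dH(x,y):(x,y)\in\mathbb{Z}^2\}=\{N^dH(x,\nu y):(x,y)\in\mathbb{Z}^2\}.$$ Then $N=1$ and $D\mid\nu$. -}

module Defs where

open import Data.Nat using (ℕ; zero; suc; _∸_)
open import Data.Integer using (ℤ; _+_; _*_; _^_; 0ℤ)
open import Data.Fin using (Fin; toℕ)
open import Data.Vec using (Vec; lookup)
open import Data.Product using (∃; ∃-syntax; _×_)
open import Relation.Binary.PropositionalEquality using (_≡_)
open import Relation.Nullary using (¬_)

-- A binary form of degree d with integer coefficients:
-- H(X,Y) = Σ_{i=0}^{d} a_i X^(d-i) Y^i, given by its coefficient vector (a_0,…,a_d).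
BinaryForm : ℕ → Set
BinaryForm d = Vec ℤ (suc d)

sumFin : ∀ n → (Fin n → ℤ) → ℤ
sumFin zero    f = 0ℤ
sumFin (suc n) f = f Fin.zero + sumFin n (λ i → f (Fin.suc i))

evalForm : ∀ {d} → BinaryForm d → ℤ → ℤ → ℤ
evalForm {d} a x y =
  sumFin (suc d) (λ i → lookup a i * (x ^ (d ∸ toℕ i)) * (y ^ toℕ i))

-- H is not the zero form (so it genuinely has degree d)
NonZeroForm : ∀ {d} → BinaryForm d → Set
NonZeroForm a = ∃[ i ] ¬ (lookup a i ≡ 0ℤ)

SameValueSet : (ℤ → ℤ → ℤ) → (ℤ → ℤ → ℤ) → Set
SameValueSet f g =
  (∀ x y → ∃[ x′ ] ∃[ y′ ] f x y ≡ g x′ y′) ×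
  (∀ x y → ∃[ x′ ] ∃[ y′ ] g x y ≡ f x′ y′)

{-# OPTIONS --safe #-}
module Submission where

-- The first inclusion says D^d·V ⊆ N^d·V for the value set V of H, which contains some h ≠ 0.
-- Iterating it k times gives N^(dk) ∣ D^(dk)·|h| for all k; once N and D are divided by their gcd,
-- the coprime part N′ of N satisfies N′^(dk) ∣ |h|, which for large k forces N′ = 1, i.e. N ∣ D.
-- Since H(νx, νy) = ν^d H(x, y), the second inclusion gives (Nν)^d·V ⊆ D^d·V, hence D ∣ Nν
-- in the same way. As gcd(D, N) = 1, N = 1 and D ∣ ν.

open import Defs
open import Data.Nat using (ℕ; _≥_)
open import Data.Nat.Divisibility using (_∣_)
open import Data.Nat.GCD using (gcd)
open import Data.Integer using (ℤ; +_; _*_; _^_)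
open import Relation.Binary.PropositionalEquality using (_≡_)
open import Data.Product using (_×_)

open import Function using (_∘_)
open import Data.Nat.Base as ℕ using (zero; suc; NonZero; _<_; _≤_; _∸_)
import Data.Nat.Properties as ℕ
open import Data.Nat.Divisibility
  using (divides; ∣⇒≤; ∣1⇒≡1; ∣-refl; ∣m⇒∣m*n; *-cancelˡ-∣)
open import Data.Nat.GCD using (gcd[m,n]∣m; gcd[m,n]∣n; gcd[m,n]≢0; gcd-greatest; m/gcd[m,n]≢0)
open import Data.Nat.Coprimality as Coprime
  using (Coprime; coprime-divisor; coprime-factors; coprime-/gcd)
open import Data.Nat.DivMod using (_/_; m*[n/m]≡n)
open import Data.Integer.Base as ℤ using (0ℤ; 1ℤ; +[1+_]; ∣_∣; _+_)
import Data.Integer.Properties as ℤ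
import Data.Integer.Divisibility.Signed as ℤ
open import Data.Integer.Solver using (module +-*-Solver)
open import Algebra.Properties.CommutativeSemigroup ℤ.*-commutativeSemigroup
  using (interchange; x∙yz≈y∙xz)
open import Data.Fin using (Fin; toℕ)
import Data.Fin.Properties as Fin
open import Data.Vec using (Vec; []; _∷_; lookup)
open import Data.Product using (∃-syntax; _,_; uncurry)
open import Data.Sum using (inj₁; [_,_]′)
open import Relation.Nullary using (yes; no)
open import Relation.Binary.PropositionalEquality
  using (refl; sym; trans; cong; cong₂; subst; subst₂; _≢_; module ≡-Reasoning)
open ≡-Reasoning

n<2^n : ∀ n → n < 2 ℕ.^ n
n<2^n zero    = ℕ.z<s
n<2^n (suc n) = ℕ.+-mono-≤ (ℕ.m^n>0 2 n) (ℕ.≤-trans (n<2^n n) (ℕ.m≤m+n _ 0))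

m^n≤o<2^n⇒m<2 : ∀ {m o} n → m ℕ.^ n ≤ o → o < 2 ℕ.^ n → m < 2
m^n≤o<2^n⇒m<2 n mⁿ≤o o<2ⁿ =
  ℕ.≰⇒> (λ 2≤m → ℕ.<⇒≱ o<2ⁿ (ℕ.≤-trans (ℕ.^-monoˡ-≤ n 2≤m) mⁿ≤o))

[m*n]^o≡m^o*n^o : ∀ m n o → (m ℕ.* n) ℕ.^ o ≡ m ℕ.^ o ℕ.* n ℕ.^ o
[m*n]^o≡m^o*n^o m n zero    = refl
[m*n]^o≡m^o*n^o m n (suc o) =
  trans (cong (m ℕ.* n ℕ.*_) ([m*n]^o≡m^o*n^o m n o))
        (ℕ.[m*n]*[o*p]≡[m*o]*[n*p] m n (m ℕ.^ o) (n ℕ.^ o))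

coprime-^ˡ : ∀ {m n} o → Coprime m n → Coprime (m ℕ.^ o) n
coprime-^ˡ zero    _   (d∣1 , _)      = ∣1⇒≡1 d∣1
coprime-^ˡ {m} (suc o) m⊥n (d∣m*mᵒ , d∣n) =
  coprime-^ˡ o m⊥n (coprime-factors m⊥n (d∣m*mᵒ , ∣m⇒∣m*n (m ℕ.^ o) d∣n) , d∣n)

coprime-^ : ∀ {m n} o → Coprime m n → Coprime (m ℕ.^ o) (n ℕ.^ o)
coprime-^ o = Coprime.sym ∘ coprime-^ˡ o ∘ Coprime.sym ∘ coprime-^ˡ o

-- Writing a = g a′, b = g b′ with g = gcd a b, the hypothesis becomes a′ⁿ ∣ b′ⁿ h,
-- so a′ⁿ ∣ h by coprimality; the bound on h then leaves only a′ = 1.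
^∣^*⇒∣ : ∀ {a b h} n .{{_ : NonZero a}} .{{_ : NonZero h}} →
         h < 2 ℕ.^ n → a ℕ.^ n ∣ b ℕ.^ n ℕ.* h → a ∣ b
^∣^*⇒∣ {a} {b} {h} n h<2ⁿ aⁿ∣bⁿh = subst (_∣ b) g≡a (gcd[m,n]∣n a b)
  where
  g : ℕ
  g = gcd a b
  instance
    g≢0 : NonZero g
    g≢0 = ℕ.≢-nonZero (gcd[m,n]≢0 a b (inj₁ (ℕ.≢-nonZero⁻¹ a)))
  a′ b′ : ℕ
  a′ = a / g
  b′ = b / g
  cⁿ≡gⁿ*[c/g]ⁿ : ∀ {c} → g ∣ c → c ℕ.^ n ≡ g ℕ.^ n ℕ.* (c / g) ℕ.^ n
  cⁿ≡gⁿ*[c/g]ⁿ g∣c = trans (cong (ℕ._^ n) (sym (m*[n/m]≡n g∣c))) ([m*n]^o≡m^o*n^o g _ n)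
  a′ⁿ∣b′ⁿh : a′ ℕ.^ n ∣ b′ ℕ.^ n ℕ.* h
  a′ⁿ∣b′ⁿh = *-cancelˡ-∣ (g ℕ.^ n) {{ℕ.m^n≢0 g n}} (subst₂ _∣_
    (cⁿ≡gⁿ*[c/g]ⁿ (gcd[m,n]∣m a b))
    (trans (cong (ℕ._* h) (cⁿ≡gⁿ*[c/g]ⁿ (gcd[m,n]∣n a b))) (ℕ.*-assoc (g ℕ.^ n) (b′ ℕ.^ n) h))
    aⁿ∣bⁿh)
  a′ⁿ∣h : a′ ℕ.^ n ∣ h
  a′ⁿ∣h = coprime-divisor (coprime-^ n (coprime-/gcd a b)) a′ⁿ∣b′ⁿh
  a′≡1 : a′ ≡ 1
  a′≡1 = ℕ.≤-antisym (ℕ.s≤s⁻¹ (m^n≤o<2^n⇒m<2 n (∣⇒≤ a′ⁿ∣h) h<2ⁿ))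
                     (ℕ.n≢0⇒n>0 (m/gcd[m,n]≢0 a b))
  g≡a : g ≡ a
  g≡a = begin
    g           ≡⟨ ℕ.*-identityʳ g ⟨
    g ℕ.* 1     ≡⟨ cong (g ℕ.*_) a′≡1 ⟨
    g ℕ.* a′    ≡⟨ m*[n/m]≡n (gcd[m,n]∣m a b) ⟩
    a           ∎

^∣^⇒∣ : ∀ {a b} n .{{_ : NonZero n}} .{{_ : NonZero a}} → a ℕ.^ n ∣ b ℕ.^ n → a ∣ b
^∣^⇒∣ n aⁿ∣bⁿ = ^∣^*⇒∣ n (ℕ.≤-<-trans (ℕ.>-nonZero⁻¹ n) (n<2^n n))
                          (subst (_ ∣_) (sym (ℕ.*-identityʳ _)) aⁿ∣bⁿ)

[i*j]^n≡i^n*j^n : ∀ i j n → (i * j) ^ n ≡ i ^ n * j ^ n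
[i*j]^n≡i^n*j^n i j zero    = refl
[i*j]^n≡i^n*j^n i j (suc n) =
  trans (cong (i * j *_) ([i*j]^n≡i^n*j^n i j n)) (interchange i j (i ^ n) (j ^ n))

pos-^ : ∀ m n → + (m ℕ.^ n) ≡ (+ m) ^ n
pos-^ m zero    = refl
pos-^ m (suc n) = trans (ℤ.pos-* m (m ℕ.^ n)) (cong (+ m *_) (pos-^ m n))

ScalesInto : ∀ {X : Set} → (X → ℤ) → ℤ → ℤ → Set
ScalesInto f A B = ∀ x → ∃[ x′ ] A * f x ≡ B * f x′

scalesInto-^ : ∀ {X : Set} {f : X → ℤ} {A B} → ScalesInto f A B → ∀ k → ScalesInto f (A ^ k) (B ^ k)
scalesInto-^         A·f⊆B·f zero    x = x , refl
scalesInto-^ {f = f} {A} {B} A·f⊆B·f (suc k) x with scalesInto-^ A·f⊆B·f k x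
... | y , Aᵏfx≡Bᵏfy with A·f⊆B·f y
... | x′ , Afy≡Bfx′ = x′ , (begin
  A * A ^ k * f x      ≡⟨ ℤ.*-assoc A (A ^ k) (f x) ⟩
  A * (A ^ k * f x)    ≡⟨ cong (A *_) Aᵏfx≡Bᵏfy ⟩
  A * (B ^ k * f y)    ≡⟨ x∙yz≈y∙xz A (B ^ k) (f y) ⟩
  B ^ k * (A * f y)    ≡⟨ cong (B ^ k *_) Afy≡Bfx′ ⟩
  B ^ k * (B * f x′)   ≡⟨ x∙yz≈y∙xz (B ^ k) B (f x′) ⟩
  B * (B ^ k * f x′)   ≡⟨ ℤ.*-assoc B (B ^ k) (f x′) ⟨
  B * B ^ k * f x′     ∎)

+a*u≡+b*v⇒b∣a*∣u∣ : ∀ {a b u v} → + a * u ≡ + b * v → b ∣ a ℕ.* ∣ u ∣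
+a*u≡+b*v⇒b∣a*∣u∣ {a} {b} {u} {v} au≡bv = divides ∣ v ∣ (begin
  a ℕ.* ∣ u ∣    ≡⟨ ℤ.abs-* (+ a) u ⟨
  ∣ + a * u ∣    ≡⟨ cong ∣_∣ au≡bv ⟩
  ∣ + b * v ∣    ≡⟨ ℤ.abs-* (+ b) v ⟩
  b ℕ.* ∣ v ∣    ≡⟨ ℕ.*-comm b ∣ v ∣ ⟩
  ∣ v ∣ ℕ.* b    ∎)

-- Scaling h = |f x| times suffices, since h < 2ʰ.
scalesInto⇒∣ : ∀ {X : Set} {f : X → ℤ} {a b} .{{_ : NonZero b}} →
               ∃[ x ] f x ≢ 0ℤ → ScalesInto f (+ a) (+ b) → b ∣ a
scalesInto⇒∣ {f = f} {a} {b} (x , fx≢0) a·f⊆b·f with scalesInto-^ a·f⊆b·f ∣ f x ∣ x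
... | x′ , aʰfx≡bʰfx′ = ^∣^*⇒∣ h (n<2^n h) (+a*u≡+b*v⇒b∣a*∣u∣ {a ℕ.^ h}
  (subst₂ (λ A B → A * f x ≡ B * f x′) (sym (pos-^ a h)) (sym (pos-^ b h)) aʰfx≡bʰfx′))
  where
  h : ℕ
  h = ∣ f x ∣
  instance
    h≢0 : NonZero h
    h≢0 = ℕ.≢-nonZero (fx≢0 ∘ ℤ.∣i∣≡0⇒i≡0)

scalesInto-^⇒∣ : ∀ {X : Set} {f : X → ℤ} {a b} d .{{_ : NonZero d}} .{{_ : NonZero b}} →
                 ∃[ x ] f x ≢ 0ℤ → ScalesInto f ((+ a) ^ d) ((+ b) ^ d) → b ∣ a
scalesInto-^⇒∣ {f = f} {a} {b} d f≢0 aᵈ·f⊆bᵈ·f = ^∣^⇒∣ d (scalesInto⇒∣ {{ℕ.m^n≢0 b d}} f≢0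
  (subst₂ (ScalesInto f) (sym (pos-^ a d)) (sym (pos-^ b d)) aᵈ·f⊆bᵈ·f))

sumFin-cong : ∀ n {f g : Fin n → ℤ} → (∀ i → f i ≡ g i) → sumFin n f ≡ sumFin n g
sumFin-cong zero    f≗g = refl
sumFin-cong (suc n) f≗g = cong₂ _+_ (f≗g Fin.zero) (sumFin-cong n (f≗g ∘ Fin.suc))

*-distribˡ-sumFin : ∀ n c (f : Fin n → ℤ) → c * sumFin n f ≡ sumFin n (λ i → c * f i)
*-distribˡ-sumFin zero    c f = ℤ.*-zeroʳ c
*-distribˡ-sumFin (suc n) c f =
  trans (ℤ.*-distribˡ-+ c (f Fin.zero) _)
        (cong (_+_ (c * f Fin.zero)) (*-distribˡ-sumFin n c (f ∘ Fin.suc)))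

monomial-homogeneous : ∀ a c x y k j →
  a * (c * x) ^ k * (c * y) ^ j ≡ c ^ (k ℕ.+ j) * (a * x ^ k * y ^ j)
monomial-homogeneous a c x y k j = begin
  a * (c * x) ^ k * (c * y) ^ j
    ≡⟨ cong₂ (λ u v → a * u * v) ([i*j]^n≡i^n*j^n c x k) ([i*j]^n≡i^n*j^n c y j) ⟩
  a * (c ^ k * x ^ k) * (c ^ j * y ^ j)
    ≡⟨ rearrange a (c ^ k) (x ^ k) (c ^ j) (y ^ j) ⟩
  c ^ k * c ^ j * (a * x ^ k * y ^ j)
    ≡⟨ cong (_* (a * x ^ k * y ^ j)) (ℤ.^-distribˡ-+-* c k j) ⟨
  c ^ (k ℕ.+ j) * (a * x ^ k * y ^ j)
    ∎
  where
  open +-*-Solver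
  rearrange : ∀ a p u q v → a * (p * u) * (q * v) ≡ p * q * (a * u * v)
  rearrange = solve 5 (λ a p u q v → a :* (p :* u) :* (q :* v) := p :* q :* (a :* u :* v)) refl

evalForm-homogeneous : ∀ {d} (H : BinaryForm d) c x y →
  evalForm H (c * x) (c * y) ≡ c ^ d * evalForm H x y
evalForm-homogeneous {d} H c x y = begin
  evalForm H (c * x) (c * y)           ≡⟨ sumFin-cong (suc d) term ⟩
  sumFin (suc d) (λ i → c ^ d * mon i) ≡⟨ *-distribˡ-sumFin (suc d) (c ^ d) mon ⟨
  c ^ d * evalForm H x y               ∎
  where
  mon : Fin (suc d) → ℤ
  mon i = lookup H i * x ^ (d ∸ toℕ i) * y ^ toℕ i
  term : ∀ i → lookup H i * (c * x) ^ (d ∸ toℕ i) * (c * y) ^ toℕ i ≡ c ^ d * mon i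
  term i = trans (monomial-homogeneous (lookup H i) c x y (d ∸ toℕ i) (toℕ i))
                 (cong (λ e → c ^ e * mon i) (ℕ.m∸n+n≡m (Fin.toℕ≤pred[n] i)))

evalForm-rescale : ∀ {d} (H : BinaryForm d) m n x y →
  (m * n) ^ d * evalForm H x y ≡ m ^ d * evalForm H (n * x) (n * y)
evalForm-rescale {d} H m n x y = begin
  (m * n) ^ d * evalForm H x y            ≡⟨ cong (_* evalForm H x y) ([i*j]^n≡i^n*j^n m n d) ⟩
  m ^ d * n ^ d * evalForm H x y          ≡⟨ ℤ.*-assoc (m ^ d) (n ^ d) (evalForm H x y) ⟩
  m ^ d * (n ^ d * evalForm H x y)        ≡⟨ cong (m ^ d *_) (evalForm-homogeneous H n x y) ⟨
  m ^ d * evalForm H (n * x) (n * y)      ∎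

horner : ∀ {n} → Vec ℤ n → ℤ → ℤ
horner []       t = 0ℤ
horner (a ∷ as) t = a + t * horner as t

sumFin-horner : ∀ {n} (v : Vec ℤ n) t → sumFin n (λ i → lookup v i * t ^ toℕ i) ≡ horner v t
sumFin-horner []               t = refl
sumFin-horner {suc n} (a ∷ as) t = cong₂ _+_ (ℤ.*-identityʳ a) (begin
  sumFin n (λ i → lookup as i * (t * t ^ toℕ i))
    ≡⟨ sumFin-cong n (λ i → x∙yz≈y∙xz (lookup as i) t (t ^ toℕ i)) ⟩
  sumFin n (λ i → t * (lookup as i * t ^ toℕ i))
    ≡⟨ *-distribˡ-sumFin n t _ ⟨
  t * sumFin n (λ i → lookup as i * t ^ toℕ i)
    ≡⟨ cong (t *_) (sumFin-horner as t) ⟩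
  t * horner as t
    ∎)

evalForm[1,t]≡horner : ∀ {d} (H : BinaryForm d) t → evalForm H 1ℤ t ≡ horner H t
evalForm[1,t]≡horner {d} H t = trans (sumFin-cong (suc d) drop-1ᵏ) (sumFin-horner H t)
  where
  drop-1ᵏ : ∀ i → lookup H i * 1ℤ ^ (d ∸ toℕ i) * t ^ toℕ i ≡ lookup H i * t ^ toℕ i
  drop-1ᵏ i = cong (_* t ^ toℕ i)
    (trans (cong (lookup H i *_) (ℤ.^-zeroˡ (d ∸ toℕ i))) (ℤ.*-identityʳ (lookup H i)))

a+[1+∣a∣]*s≢0 : ∀ {a} s → a ≢ 0ℤ → a + +[1+ ∣ a ∣ ] * s ≢ 0ℤ
a+[1+∣a∣]*s≢0 {a} s a≢0 a+ts≡0 = ℕ.<-irrefl refl (∣⇒≤ {{∣a∣≢0}} (ℤ.∣⇒∣ᵤ t∣a))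
  where
  ∣a∣≢0 : NonZero ∣ a ∣
  ∣a∣≢0 = ℕ.≢-nonZero (a≢0 ∘ ℤ.∣i∣≡0⇒i≡0)
  t∣a : +[1+ ∣ a ∣ ] ℤ.∣ a
  t∣a = ℤ.∣m+n∣n⇒∣m (subst (_ ℤ.∣_) (sym a+ts≡0) (ℤ.divides 0ℤ refl)) (ℤ.∣m⇒∣m*n s ℤ.∣-refl)

-- Take t = 1 + |a| for the lowest nonzero coefficient a: the higher ones only add a multiple of t.
nonZero⇒∃horner≢0 : ∀ {n} (v : Vec ℤ n) → ∃[ i ] lookup v i ≢ 0ℤ → ∃[ m ] horner v +[1+ m ] ≢ 0ℤ
nonZero⇒∃horner≢0 (a ∷ as) (Fin.zero , a≢0) = ∣ a ∣ , a+[1+∣a∣]*s≢0 _ a≢0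
nonZero⇒∃horner≢0 (a ∷ as) (Fin.suc i , asᵢ≢0) with a ℤ.≟ 0ℤ
... | no a≢0  = ∣ a ∣ , a+[1+∣a∣]*s≢0 _ a≢0
... | yes refl with nonZero⇒∃horner≢0 as (i , asᵢ≢0)
...   | m , p≢0 = m , λ tp≡0 → [ (λ ()) , p≢0 ]′
                       (ℤ.i*j≡0⇒i≡0∨j≡0 +[1+ m ] (trans (sym (ℤ.+-identityˡ _)) tp≡0))

nonZeroForm⇒∃value≢0 : ∀ {d} (H : BinaryForm d) → NonZeroForm H →
                       ∃[ p ] uncurry (evalForm H) p ≢ 0ℤ
nonZeroForm⇒∃value≢0 H H≢0 with nonZero⇒∃horner≢0 H H≢0
... | m , p≢0 = (1ℤ , +[1+ m ]) , p≢0 ∘ trans (sym (evalForm[1,t]≡horner H +[1+ m ]))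

lemma6p11 : (d : ℕ) → d ≥ 1 → (H : BinaryForm d) → NonZeroForm H →
    (D N ν : ℕ) → D ≥ 1 → N ≥ 1 → ν ≥ 1 → gcd D N ≡ 1 →
    SameValueSet (λ x y → (+ D) ^ d * evalForm H x y)
                 (λ x y → (+ N) ^ d * evalForm H x ((+ ν) * y)) →
    (N ≡ 1) × (D ∣ ν)
lemma6p11 d d≥1 H H≢0 D N ν D≥1 N≥1 _ gcd≡1 (DᵈH⊆NᵈHν , NᵈHν⊆DᵈH) = N≡1 , D∣ν
  where
  instance
    d≢0 : NonZero d
    d≢0 = ℕ.>-nonZero d≥1
    D≢0 : NonZero D
    D≢0 = ℕ.>-nonZero D≥1
    N≢0 : NonZero N
    N≢0 = ℕ.>-nonZero N≥1
  V : ℤ × ℤ → ℤ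
  V = uncurry (evalForm H)
  Dᵈ·V⊆Nᵈ·V : ScalesInto V ((+ D) ^ d) ((+ N) ^ d)
  Dᵈ·V⊆Nᵈ·V (x , y) with DᵈH⊆NᵈHν x y
  ... | x′ , y′ , eq = (x′ , + ν * y′) , eq
  [Nν]ᵈ·V⊆Dᵈ·V : ScalesInto V ((+ (N ℕ.* ν)) ^ d) ((+ D) ^ d)
  [Nν]ᵈ·V⊆Dᵈ·V (x , y) with NᵈHν⊆DᵈH (+ ν * x) y
  ... | x′ , y′ , eq = (x′ , y′) ,
    trans (cong (λ c → c ^ d * V (x , y)) (ℤ.pos-* N ν))
          (trans (evalForm-rescale H (+ N) (+ ν) x y) eq)
  N∣D : N ∣ D
  N∣D = scalesInto-^⇒∣ d (nonZeroForm⇒∃value≢0 H H≢0) Dᵈ·V⊆Nᵈ·V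
  N≡1 : N ≡ 1
  N≡1 = ∣1⇒≡1 (subst (N ∣_) gcd≡1 (gcd-greatest N∣D ∣-refl))
  D∣ν : D ∣ ν
  D∣ν = subst (D ∣_) (trans (cong (ℕ._* ν) N≡1) (ℕ.*-identityˡ ν))
              (scalesInto-^⇒∣ d (nonZeroForm⇒∃value≢0 H H≢0) [Nν]ᵈ·V⊆Dᵈ·V)
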